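{- Let $G$ be a connected twin-free bipartite graph on $n\geq 3$ vertices that is not isomorphic to the path $P_4$. Then $\gamma^{\mathrm{ID}}(G)\leq \frac{2n}{3}$.
   Context: All graphs are finite, simple and undirected. $N(v)$ and $N[v]$ denote the open and closed neighbourhoods of $v$. A graph is twin-free if there are no two distinct vertices $u,v$ with $N(u)=N(v)$ or $N[u]=N[v]$. A set $C\subseteq V(G)$ is an identifying code if for every vertex $v$ the set $N[v]\cap C$ is nonempty and for every two distinct vertices $u,v$ we have $N[u]\cap C\neq N[v]\cap C$. $\gamma^{\mathrm{ID}}(G)$ is the minimum size of an identifying code of $G$. -}

module Defs where

open import Data.Nat using (ℕ; suc; _≤_; _*_)
open import Data.Fin using (Fin; zero; suc; toℕ)
open import Data.Fin.Subset using (Subset; _∈_; ∣_∣)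
open import Data.Product using (Σ; _×_; _,_; ∃)
open import Data.Sum using (_⊎_)
open import Data.Bool using (Bool)
open import Data.List using (List; []; _∷_)
open import Relation.Nullary using (¬_; Dec)
open import Relation.Binary.PropositionalEquality using (_≡_; _≢_)
open import Function.Bundles using (_⤖_; Func; Bijection)
open import Data.Nat using (_+_)

record Graph (n : ℕ) : Set₁ where
  field
    Adj   : Fin n → Fin n → Set
    adj?  : ∀ u v → Dec (Adj u v)
    sym   : ∀ {u v} → Adj u v → Adj v u
    irrefl : ∀ {u} → ¬ Adj u u

module _ {n : ℕ} (G : Graph n) where
  open Graph G

  InClosedNbhd : Fin n → Fin n → Set
  InClosedNbhd v w = (w ≡ v) ⊎ Adj v w

  data Walk : Fin n → Fin n → Set where
    here : ∀ {u} → Walk u u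
    step : ∀ {u w v} → Adj u w → Walk w v → Walk u v

  Connected : Set
  Connected = ∀ u v → Walk u v

  Bipartite : Set
  Bipartite = Σ (Fin n → Bool) λ f → ∀ {u v} → Adj u v → f u ≢ f v

  TwinFree : Set
  TwinFree = ∀ u v → u ≢ v →
    ¬ (∀ w → (Adj u w → Adj v w) × (Adj v w → Adj u w)) ×
    ¬ (∀ w → (InClosedNbhd u w → InClosedNbhd v w) × (InClosedNbhd v w → InClosedNbhd u w))

  IdentifyingCode : Subset n → Set
  IdentifyingCode C =
    (∀ v → ∃ λ c → c ∈ C × InClosedNbhd v c) ×
    (∀ u v → u ≢ v → ∃ λ c → c ∈ C ×
        ((InClosedNbhd u c × ¬ InClosedNbhd v c) ⊎ (InClosedNbhd v c × ¬ InClosedNbhd u c)))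

PathAdj : ∀ {m} → Fin m → Fin m → Set
PathAdj i j = (suc (toℕ i) ≡ toℕ j) ⊎ (suc (toℕ j) ≡ toℕ i)

IsoP4 : ∀ {n} → Graph n → Set
IsoP4 {n} G = Σ (Fin n ⤖ Fin 4) λ φ →
  ∀ u v → (Graph.Adj G u v → PathAdj (Bijection.to φ u) (Bijection.to φ v)) ×
          (PathAdj (Bijection.to φ u) (Bijection.to φ v) → Graph.Adj G u v)

-- Let A and B be the colour classes and L the set of leaves, and give every leaf
-- a partner at distance two from it, through its support. Then B ∪ partner[A ∩ L]
-- and A ∪ partner[B ∩ L] are identifying codes: twin-freeness separates two vertices
-- of one class by a neighbour in the other class, and a leaf is separated from its
-- support by its partner. The non-leaves V ∖ L also form an identifying code unless
-- G is P₄. The three sizes add up to at most |B| + |A ∩ L| + |A| + |B ∩ L| + |V ∖ L| = 2n,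
-- so the smallest of the three codes has at most 2n/3 vertices.
module Submission where

open import Defs
open import Data.Bool using (Bool; true)
open import Data.Bool.Properties using (¬-not) renaming (_≟_ to _≟ᵇ_)
open import Data.Empty using (⊥-elim)
open import Data.Fin using (Fin; zero; suc; toℕ; inject₁)
open import Data.Fin.Properties using (_≟_; any?; all?; ¬∀⟶∃¬)
open import Data.Fin.Subset using (Subset; _∈_; _∉_; ∣_∣; ∁; _∪_; _∩_; ⁅_⁆; inside; outside)
  renaming (⊥ to ∅)
open import Data.Fin.Subset.Properties
  using (_∈?_; x∈⁅x⁆; x∈p∪q⁺; x∈p∩q⁺; x∈∁p⇒x∉p; x∉∁p⇒x∈p; x∉p⇒x∈∁p; ∣p∣≤n; ∣∁p∣≡n∸∣p∣; ∣⁅x⁆∣≡1; ∣⊥∣≡0; ∣p∣≤∣x∷p∣)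
open import Data.Nat using (ℕ; zero; suc; _+_; _*_; _≤_; z≤n; s≤s)
open import Data.Nat.Properties
  using (≤-refl; ≤-trans; ≤-total; ≤-reflexive; +-mono-≤; +-monoʳ-≤; +-suc; m+[n∸m]≡n; suc-injective; +-identityʳ; module ≤-Reasoning)
open import Data.Nat.Tactic.RingSolver using (solve-∀)
open import Data.Product using (Σ; ∃; _×_; _,_; proj₁; proj₂)
open import Data.Sum using (_⊎_; inj₁; inj₂; [_,_]; [_,_]′) renaming (swap to ⊎-swap)
open import Data.Vec using (_∷_; []; here; there; lookup; tabulate)
open import Data.Vec.Properties using (lookup∘tabulate; lookup⇒[]=; []=⇒lookup)
open import Data.Vec.Relation.Unary.All using ([]; _∷_)
open import Data.Vec.Relation.Unary.AllPairs using ([]; _∷_)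
open import Data.Vec.Relation.Unary.Unique.Propositional using (Unique)
open import Data.Vec.Relation.Unary.Unique.Propositional.Properties using (lookup-injective)
open import Function using (_∘_; mk⤖)
open import Relation.Nullary using (¬_; Dec; yes; no; does; contradiction)
open import Relation.Nullary.Decidable using (dec-true; decidable-stable; _×-dec_; _→-dec_; ¬?)
open import Level using (Level)
open import Relation.Unary using (Pred; Decidable)
open import Relation.Binary.PropositionalEquality
  using (_≡_; _≢_; refl; sym; trans; cong; cong₂; subst; subst₂; ≢-sym)

private variable
  ℓ : Level
  m n : ℕ

fromDec : {P : Pred (Fin n) ℓ} → Decidable P → Subset n
fromDec P? = tabulate (does ∘ P?)

∈-fromDec⁺ : {P : Pred (Fin n) ℓ} (P? : Decidable P) {x : Fin n} → P x → x ∈ fromDec P?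
∈-fromDec⁺ P? {x} px = lookup⇒[]= x _ (trans (lookup∘tabulate (does ∘ P?) x) (dec-true (P? x) px))

∈-fromDec⁻ : {P : Pred (Fin n) ℓ} (P? : Decidable P) {x : Fin n} → x ∈ fromDec P? → P x
∈-fromDec⁻ P? {x} x∈ with P? x | trans (sym (lookup∘tabulate (does ∘ P?) x)) ([]=⇒lookup x∈)
... | yes px | _  = px
... | no _   | ()

∣p∪q∣≤∣p∣+∣q∣ : (p q : Subset n) → ∣ p ∪ q ∣ ≤ ∣ p ∣ + ∣ q ∣
∣p∪q∣≤∣p∣+∣q∣ []            []            = z≤n
∣p∪q∣≤∣p∣+∣q∣ (inside  ∷ p) (t       ∷ q) = s≤s (≤-trans (∣p∪q∣≤∣p∣+∣q∣ p q) (+-monoʳ-≤ ∣ p ∣ (∣p∣≤∣x∷p∣ t q)))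
∣p∪q∣≤∣p∣+∣q∣ (outside ∷ p) (inside  ∷ q) = ≤-trans (s≤s (∣p∪q∣≤∣p∣+∣q∣ p q)) (≤-reflexive (sym (+-suc ∣ p ∣ ∣ q ∣)))
∣p∪q∣≤∣p∣+∣q∣ (outside ∷ p) (outside ∷ q) = ∣p∪q∣≤∣p∣+∣q∣ p q

∣p∣+∣∁p∣≡n : (p : Subset n) → ∣ p ∣ + ∣ ∁ p ∣ ≡ n
∣p∣+∣∁p∣≡n p = trans (cong (∣ p ∣ +_) (∣∁p∣≡n∸∣p∣ p)) (m+[n∸m]≡n (∣p∣≤n p))

∣p∩q∣+∣∁p∩q∣≡∣q∣ : (p q : Subset n) → ∣ p ∩ q ∣ + ∣ ∁ p ∩ q ∣ ≡ ∣ q ∣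
∣p∩q∣+∣∁p∩q∣≡∣q∣ []            []            = refl
∣p∩q∣+∣∁p∩q∣≡∣q∣ (inside  ∷ p) (inside  ∷ q) = cong suc (∣p∩q∣+∣∁p∩q∣≡∣q∣ p q)
∣p∩q∣+∣∁p∩q∣≡∣q∣ (outside ∷ p) (inside  ∷ q) = trans (+-suc ∣ p ∩ q ∣ _) (cong suc (∣p∩q∣+∣∁p∩q∣≡∣q∣ p q))
∣p∩q∣+∣∁p∩q∣≡∣q∣ (inside  ∷ p) (outside ∷ q) = ∣p∩q∣+∣∁p∩q∣≡∣q∣ p q
∣p∩q∣+∣∁p∩q∣≡∣q∣ (outside ∷ p) (outside ∷ q) = ∣p∩q∣+∣∁p∩q∣≡∣q∣ p q

image : (Fin m → Fin n) → Subset m → Subset n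
image f []            = ∅
image f (inside  ∷ p) = ⁅ f zero ⁆ ∪ image (f ∘ suc) p
image f (outside ∷ p) = image (f ∘ suc) p

∈-image : (f : Fin m → Fin n) {p : Subset m} {x : Fin m} → x ∈ p → f x ∈ image f p
∈-image f {inside  ∷ p} here        = x∈p∪q⁺ (inj₁ (x∈⁅x⁆ (f zero)))
∈-image f {inside  ∷ p} (there x∈p) = x∈p∪q⁺ (inj₂ (∈-image (f ∘ suc) x∈p))
∈-image f {outside ∷ p} (there x∈p) = ∈-image (f ∘ suc) x∈p

∣image∣≤∣p∣ : (f : Fin m → Fin n) (p : Subset m) → ∣ image f p ∣ ≤ ∣ p ∣
∣image∣≤∣p∣ {n = n} f [] = ≤-reflexive (∣⊥∣≡0 n)
∣image∣≤∣p∣ f (inside ∷ p) = begin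
  ∣ ⁅ f zero ⁆ ∪ image (f ∘ suc) p ∣       ≤⟨ ∣p∪q∣≤∣p∣+∣q∣ ⁅ f zero ⁆ _ ⟩
  ∣ ⁅ f zero ⁆ ∣ + ∣ image (f ∘ suc) p ∣  ≤⟨ +-mono-≤ (≤-reflexive (∣⁅x⁆∣≡1 (f zero))) (∣image∣≤∣p∣ (f ∘ suc) p) ⟩
  suc ∣ p ∣                                ∎
  where open ≤-Reasoning
∣image∣≤∣p∣ f (outside ∷ p) = ∣image∣≤∣p∣ (f ∘ suc) p

classCode : (Fin n → Fin n) → Subset n → Subset n → Subset n
classCode f L A = ∁ A ∪ image f (A ∩ L)

∣classCode∣≤ : (f : Fin n → Fin n) (L A : Subset n) → ∣ classCode f L A ∣ ≤ ∣ ∁ A ∣ + ∣ A ∩ L ∣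
∣classCode∣≤ f L A = ≤-trans (∣p∪q∣≤∣p∣+∣q∣ (∁ A) _) (+-monoʳ-≤ ∣ ∁ A ∣ (∣image∣≤∣p∣ f (A ∩ L)))

classCodes-total : (f : Fin n → Fin n) (L A : Subset n) →
  ∣ classCode f L A ∣ + ∣ classCode f L (∁ A) ∣ + ∣ ∁ L ∣ ≤ 2 * n
classCodes-total {n} f L A = begin
  ∣ classCode f L A ∣ + ∣ classCode f L (∁ A) ∣ + ∣ ∁ L ∣
    ≤⟨ +-mono-≤ (+-mono-≤ (∣classCode∣≤ f L A) (∣classCode∣≤ f L (∁ A))) ≤-refl ⟩
  (∣ ∁ A ∣ + ∣ A ∩ L ∣) + (∣ ∁ (∁ A) ∣ + ∣ ∁ A ∩ L ∣) + ∣ ∁ L ∣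
    ≡⟨ rearrange (∣ ∁ A ∣) (∣ A ∩ L ∣) (∣ ∁ (∁ A) ∣) (∣ ∁ A ∩ L ∣) (∣ ∁ L ∣) ⟩
  (∣ ∁ A ∣ + ∣ ∁ (∁ A) ∣) + ((∣ A ∩ L ∣ + ∣ ∁ A ∩ L ∣) + ∣ ∁ L ∣)
    ≡⟨ cong₂ (λ a b → a + (b + ∣ ∁ L ∣)) (∣p∣+∣∁p∣≡n (∁ A)) (∣p∩q∣+∣∁p∩q∣≡∣q∣ A L) ⟩
  n + (∣ L ∣ + ∣ ∁ L ∣)
    ≡⟨ cong (λ b → n + b) (trans (∣p∣+∣∁p∣≡n L) (sym (+-identityʳ n))) ⟩
  2 * n ∎
  where
  open ≤-Reasoning
  rearrange : ∀ a b c d e → (a + b) + (c + d) + e ≡ (a + c) + ((b + d) + e)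
  rearrange = solve-∀

avoid₂ : (u v : Fin (3 + m)) → ∃ λ z → z ≢ u × z ≢ v
avoid₂ zero          zero          = suc zero       , (λ ()) , (λ ())
avoid₂ zero          (suc zero)    = suc (suc zero) , (λ ()) , (λ ())
avoid₂ zero          (suc (suc v)) = suc zero       , (λ ()) , (λ ())
avoid₂ (suc zero)    zero          = suc (suc zero) , (λ ()) , (λ ())
avoid₂ (suc zero)    (suc zero)    = zero           , (λ ()) , (λ ())
avoid₂ (suc zero)    (suc (suc v)) = zero           , (λ ()) , (λ ())
avoid₂ (suc (suc u)) zero          = suc zero       , (λ ()) , (λ ())
avoid₂ (suc (suc u)) (suc zero)    = zero           , (λ ()) , (λ ())
avoid₂ (suc (suc u)) (suc (suc v)) = zero           , (λ ()) , (λ ())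

consecutive : {i j : Fin (suc n)} → suc (toℕ i) ≡ toℕ j → ∃ λ k → i ≡ inject₁ k × j ≡ suc k
consecutive {i = zero}  {zero}        ()
consecutive {i = zero}  {suc zero}    refl = zero , refl , refl
consecutive {i = zero}  {suc (suc j)} ()
consecutive {i = suc i} {zero}        ()
consecutive {suc n} {i = suc i} {suc j} e with consecutive {i = i} {j} (suc-injective e)
... | k , refl , refl = suc k , refl , refl

module _ {A : Set} (size : A → ℕ) (P : A → Set) where

  smaller : (x y : A) → P x → P y → Σ A λ c → P c × size c ≤ size x × size c ≤ size y
  smaller x y px py with ≤-total (size x) (size y)
  ... | inj₁ x≤y = x , px , ≤-refl , x≤y
  ... | inj₂ y≤x = y , py , y≤x , ≤-refl

  smallest-of-three : ∀ {k} (x y z : A) → P x → P y → P z →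
    size x + size y + size z ≤ k → Σ A λ c → P c × 3 * size c ≤ k
  smallest-of-three x y z px py pz total with smaller x y px py
  ... | c , pc , c≤x , c≤y with smaller c z pc pz
  ...   | d , pd , d≤c , d≤z = d , pd , ≤-trans (≤-reflexive (thrice (size d))) (≤-trans bound total)
    where
    thrice : ∀ a → 3 * a ≡ a + a + a
    thrice = solve-∀
    bound : size d + size d + size d ≤ size x + size y + size z
    bound = +-mono-≤ (+-mono-≤ (≤-trans d≤c c≤x) (≤-trans d≤c c≤y)) d≤z

module GraphBasics {n : ℕ} (G : Graph n) where
  open Graph G renaming (sym to adj-sym)

  N[_] : Fin n → Fin n → Set
  N[ v ] = InClosedNbhd G v

  ∉N[] : ∀ {v c} → c ≢ v → ¬ Adj v c → ¬ N[ v ] c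
  ∉N[] c≢v ¬vc = [ c≢v , ¬vc ]

  Distinguishes : Subset n → Fin n → Fin n → Set
  Distinguishes C u v = ∃ λ c → c ∈ C × ((N[ u ] c × ¬ N[ v ] c) ⊎ (N[ v ] c × ¬ N[ u ] c))

  distinguishedBy : ∀ {C u v c} → c ∈ C → N[ u ] c → ¬ N[ v ] c → Distinguishes C u v
  distinguishedBy c∈C uc ¬vc = _ , c∈C , inj₁ (uc , ¬vc)

  distinguishes-sym : ∀ {C u v} → Distinguishes C u v → Distinguishes C v u
  distinguishes-sym (c , c∈C , d) = c , c∈C , ⊎-swap d

  PendantAt : Fin n → Fin n → Set
  PendantAt a s = Adj a s × (∀ w → Adj a w → w ≡ s)

  pendantAt? : ∀ a s → Dec (PendantAt a s)
  pendantAt? a s = adj? a s ×-dec all? (λ w → adj? a w →-dec (w ≟ s))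

  Leaf : Fin n → Set
  Leaf a = ∃ (PendantAt a)

  leaf? : Decidable Leaf
  leaf? a = any? (pendantAt? a)

  leaf⇒pendantAt : ∀ {a s} → Leaf a → Adj a s → PendantAt a s
  leaf⇒pendantAt (t , _ , a-only) as = as , λ w aw → trans (a-only w aw) (sym (a-only _ as))

  other-neighbour : ∀ {x y} → Adj x y → ¬ PendantAt x y → ∃ λ w → Adj x w × w ≢ y
  other-neighbour {x} {y} xy ¬pendant with any? (λ w → adj? x w ×-dec ¬? (w ≟ y))
  ... | yes found = found
  ... | no none   = ⊥-elim (¬pendant (xy , λ w xw → decidable-stable (w ≟ y) (λ w≢y → none (w , xw , w≢y))))

  walk-first-step : ∀ {u v} → Walk G u v → u ≢ v → ∃ (Adj u)
  walk-first-step here        u≢u = contradiction refl u≢u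
  walk-first-step (step uw _) _   = _ , uw

  walk-preserves : {P : Fin n → Set} → (∀ {x y} → Adj x y → P x → P y) → ∀ {u v} → Walk G u v → P u → P v
  walk-preserves closed here          pu = pu
  walk-preserves closed (step uw walk) pu = walk-preserves closed walk (closed uw pu)

  TriangleFree : Set
  TriangleFree = ∀ {u v w} → Adj u v → Adj u w → ¬ Adj v w

  Bipartition : Subset n → Set
  Bipartition A = ∀ {u v} → Adj u v → (u ∈ A → v ∉ A) × (u ∉ A → v ∈ A)

  ∁-bipartition : ∀ {A} → Bipartition A → Bipartition (∁ A)
  ∁-bipartition bip uv =
    (λ u∈∁A v∈∁A → x∈∁p⇒x∉p v∈∁A (proj₂ (bip uv) (x∈∁p⇒x∉p u∈∁A))) ,
    (λ u∉∁A → x∉p⇒x∈∁p (proj₁ (bip uv) (x∉∁p⇒x∈p u∉∁A)))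

  colouring⇒bipartition : (col : Fin n → Bool) → (∀ {u v} → Adj u v → col u ≢ col v) →
    Bipartition (fromDec (λ v → col v ≟ᵇ true))
  colouring⇒bipartition col proper {u} {v} uv =
    (λ u∈A v∈A → proper uv (trans (∈-fromDec⁻ A? u∈A) (sym (∈-fromDec⁻ A? v∈A)))) ,
    (λ u∉A → ∈-fromDec⁺ A? (¬-not (λ v-false → proper uv (trans (¬-not (u∉A ∘ ∈-fromDec⁺ A?)) (sym v-false)))))
    where
    A? : Decidable (λ v → col v ≡ true)
    A? v = col v ≟ᵇ true

  bipartition⇒triangleFree : ∀ {A} → Bipartition A → TriangleFree
  bipartition⇒triangleFree {A} bip {u} uv uw vw with u ∈? A
  ... | yes u∈A = proj₁ (bip uw) u∈A (proj₂ (bip vw) (proj₁ (bip uv) u∈A))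
  ... | no  u∉A = proj₁ (bip vw) (proj₂ (bip uv) u∉A) (proj₂ (bip uw) u∉A)

  pendant-unique : TwinFree G → ∀ {a b s} → PendantAt a s → PendantAt b s → a ≡ b
  pendant-unique twinFree {a} {b} (as , a-only) (bs , b-only) with a ≟ b
  ... | yes a≡b = a≡b
  ... | no  a≢b = contradiction sameOpen (proj₁ (twinFree a b a≢b))
    where
    sameOpen : ∀ w → (Adj a w → Adj b w) × (Adj b w → Adj a w)
    sameOpen w = (λ aw → subst (Adj b) (sym (a-only w aw)) bs) , (λ bw → subst (Adj a) (sym (b-only w bw)) as)

  open-neighbourhoods-differ : TwinFree G → ∀ {u v} → u ≢ v →
    ∃ λ w → (Adj u w × ¬ Adj v w) ⊎ (Adj v w × ¬ Adj u w)
  open-neighbourhoods-differ twinFree {u} {v} u≢v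
    with ¬∀⟶∃¬ n _ (λ w → (adj? u w →-dec adj? v w) ×-dec (adj? v w →-dec adj? u w)) (proj₁ (twinFree u v u≢v))
  ... | w , differs with adj? u w | adj? v w
  ...   | yes uw | yes vw = contradiction ((λ _ → vw) , (λ _ → uw)) differs
  ...   | yes uw | no ¬vw = w , inj₁ (uw , ¬vw)
  ...   | no ¬uw | yes vw = w , inj₂ (vw , ¬uw)
  ...   | no ¬uw | no ¬vw = contradiction ((λ uw → contradiction uw ¬uw) , (λ vw → contradiction vw ¬vw)) differs

  isoP4 : (ψ : Fin 4 → Fin n) → (∀ i j → ψ i ≡ ψ j → i ≡ j) → (∀ x → ∃ λ i → ψ i ≡ x) →
    (∀ i j → Adj (ψ i) (ψ j) → PathAdj i j) → (∀ i j → PathAdj i j → Adj (ψ i) (ψ j)) → IsoP4 G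
  isoP4 ψ ψ-injective ψ-onto reflect preserve = mk⤖ {to = φ} (φ-injective , φ-surjective) , adjacency
    where
    φ : Fin n → Fin 4
    φ x = proj₁ (ψ-onto x)
    ψφ : ∀ x → ψ (φ x) ≡ x
    ψφ x = proj₂ (ψ-onto x)
    φ-injective : ∀ {x y} → φ x ≡ φ y → x ≡ y
    φ-injective {x} {y} eq = trans (sym (ψφ x)) (trans (cong ψ eq) (ψφ y))
    φ-surjective : ∀ i → ∃ λ x → ∀ {y} → y ≡ x → φ y ≡ i
    φ-surjective i = ψ i , λ { refl → ψ-injective _ _ (ψφ (ψ i)) }
    adjacency : ∀ x y → (Adj x y → PathAdj (φ x) (φ y)) × (PathAdj (φ x) (φ y) → Adj x y)
    adjacency x y =
      (λ xy → reflect _ _ (subst₂ Adj (sym (ψφ x)) (sym (ψφ y)) xy)) ,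
      (λ p → subst₂ Adj (ψφ x) (ψφ y) (preserve _ _ p))

module Codes {m : ℕ} (G : Graph (3 + m)) (connected : Connected G) (twinFree : TwinFree G) where
  open Graph G renaming (sym to adj-sym)
  open GraphBasics G

  has-neighbour : ∀ v → ∃ (Adj v)
  has-neighbour v = let (z , z≢v , _) = avoid₂ v v in walk-first-step (connected v z) (≢-sym z≢v)

  no-isolated-edge : ∀ {a b} → PendantAt a b → ¬ PendantAt b a
  no-isolated-edge {a} {b} (_ , a-only) (_ , b-only) =
    let (z , z≢a , z≢b) = avoid₂ a b in [ z≢a , z≢b ] (walk-preserves closed (connected a z) (inj₁ refl))
    where
    closed : ∀ {x y} → Adj x y → x ≡ a ⊎ x ≡ b → y ≡ a ⊎ y ≡ b
    closed xy (inj₁ refl) = inj₂ (a-only _ xy)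
    closed xy (inj₂ refl) = inj₁ (b-only _ xy)

  support-has-other-neighbour : ∀ {a s} → PendantAt a s → ∃ λ w → Adj s w × w ≢ a
  support-has-other-neighbour a-at-s = other-neighbour (adj-sym (proj₁ a-at-s)) (no-isolated-edge a-at-s)

  support-not-leaf : ∀ {a s} → PendantAt a s → ¬ Leaf s
  support-not-leaf a-at-s s-leaf = no-isolated-edge a-at-s (leaf⇒pendantAt s-leaf (adj-sym (proj₁ a-at-s)))

  -- a vertex at distance two from the leaf a; the value at a non-leaf is junk
  partner : Fin (3 + m) → Fin (3 + m)
  partner a with any? (λ w → any? λ s → pendantAt? a s ×-dec (adj? s w ×-dec ¬? (w ≟ a)))
  ... | yes (w , _) = w
  ... | no  _       = a

  partner-spec : ∀ {a s} → PendantAt a s → Adj s (partner a) × partner a ≢ a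
  partner-spec {a} {s} a-at-s with any? (λ w → any? λ s → pendantAt? a s ×-dec (adj? s w ×-dec ¬? (w ≟ a)))
  ... | yes (w , t , a-at-t , tw , w≢a) = subst (λ x → Adj x w) (sym (proj₂ a-at-t s (proj₁ a-at-s))) tw , w≢a
  ... | no  none = let (w , sw , w≢a) = support-has-other-neighbour a-at-s in
                   contradiction (w , s , a-at-s , sw , w≢a) none

  leaves : Subset (3 + m)
  leaves = fromDec leaf?

  classCode-identifying : ∀ {A} → Bipartition A → IdentifyingCode G (classCode partner leaves A)
  classCode-identifying {A} bip = dominating , distinguishing
    where
    C : Subset (3 + m)
    C = classCode partner leaves A

    outside∈C : ∀ {c} → c ∉ A → c ∈ C
    outside∈C c∉A = x∈p∪q⁺ (inj₁ (x∉p⇒x∈∁p c∉A))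

    partner∈C : ∀ {a s} → a ∈ A → PendantAt a s → partner a ∈ C
    partner∈C a∈A a-at-s = x∈p∪q⁺ (inj₂ (∈-image partner (x∈p∩q⁺ (a∈A , ∈-fromDec⁺ leaf? (_ , a-at-s)))))

    dominating : ∀ v → ∃ λ c → c ∈ C × N[ v ] c
    dominating v with v ∈? A
    ... | no  v∉A = v , outside∈C v∉A , inj₁ refl
    ... | yes v∈A = let (w , vw) = has-neighbour v in w , outside∈C (proj₁ (bip vw) v∈A) , inj₂ vw

    across : ∀ {u v} → u ∈ A → v ∉ A → u ≢ v → Distinguishes C u v
    across {u} {v} u∈A v∉A u≢v with adj? u v
    ... | no ¬uv = distinguishes-sym (distinguishedBy (outside∈C v∉A) (inj₁ refl) (∉N[] (≢-sym u≢v) ¬uv))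
    ... | yes uv with pendantAt? u v
    ...   | no ¬u-at-v =
            let (w , uw , w≢v) = other-neighbour uv ¬u-at-v
                w∉A = proj₁ (bip uw) u∈A
            in distinguishedBy (outside∈C w∉A) (inj₂ uw) (∉N[] w≢v (λ vw → w∉A (proj₂ (bip vw) v∉A)))
    ...   | yes u-at-v =
            let (v-p , p≢u) = partner-spec u-at-v
            in distinguishes-sym (distinguishedBy (partner∈C u∈A u-at-v) (inj₂ v-p)
                 (∉N[] p≢u (λ u-p → irrefl (subst (Adj v) (proj₂ u-at-v _ u-p) v-p))))

    within : ∀ {u v w} → u ∈ A → v ∈ A → Adj u w → ¬ Adj v w → Distinguishes C u v
    within u∈A v∈A uw ¬vw =
      let w∉A = proj₁ (bip uw) u∈A
      in distinguishedBy (outside∈C w∉A) (inj₂ uw) (∉N[] (λ w≡v → w∉A (subst (_∈ A) (sym w≡v) v∈A)) ¬vw)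

    distinguishing : ∀ u v → u ≢ v → Distinguishes C u v
    distinguishing u v u≢v with u ∈? A | v ∈? A
    ... | no  u∉A | no  v∉A = distinguishedBy (outside∈C u∉A) (inj₁ refl) (∉N[] u≢v (λ vu → u∉A (proj₂ (bip vu) v∉A)))
    ... | yes u∈A | no  v∉A = across u∈A v∉A u≢v
    ... | no  u∉A | yes v∈A = distinguishes-sym (across v∈A u∉A (≢-sym u≢v))
    ... | yes u∈A | yes v∈A with open-neighbourhoods-differ twinFree u≢v
    ...   | _ , inj₁ (uw , ¬vw) = within u∈A v∈A uw ¬vw
    ...   | _ , inj₂ (vw , ¬uw) = distinguishes-sym (within v∈A u∈A vw ¬uw)

  isoP4-of-neighbourhoods : ∀ {w u v z} → PendantAt w u → Adj u v → PendantAt z v → w ≢ v → z ≢ u →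
    (∀ y → Adj u y → y ≡ v ⊎ y ≡ w) → (∀ y → Adj v y → y ≡ u ⊎ y ≡ z) → IsoP4 G
  isoP4-of-neighbourhoods {w} {u} {v} {z} w-at-u uv z-at-v w≢v z≢u u-nbrs v-nbrs =
    isoP4 ψ (lookup-injective distinct) onto reflect preserve
    where
    ψ : Fin 4 → Fin (3 + m)
    ψ = lookup (w ∷ u ∷ v ∷ z ∷ [])

    distinct : Unique (w ∷ u ∷ v ∷ z ∷ [])
    distinct = (w≢u ∷ w≢v ∷ w≢z ∷ []) ∷ (u≢v ∷ ≢-sym z≢u ∷ []) ∷ (v≢z ∷ []) ∷ [] ∷ []
      where
      w≢u : w ≢ u
      w≢u refl = irrefl (proj₁ w-at-u)
      u≢v : u ≢ v
      u≢v refl = irrefl uv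
      v≢z : v ≢ z
      v≢z refl = irrefl (proj₁ z-at-v)
      w≢z : w ≢ z
      w≢z refl = u≢v (sym (proj₂ w-at-u v (proj₁ z-at-v)))

    nbrs : ∀ i y → Adj (ψ i) y → ∃ λ j → PathAdj i j × ψ j ≡ y
    nbrs zero                      y wy = suc zero , inj₁ refl , sym (proj₂ w-at-u y wy)
    nbrs (suc zero)                y uy = [ (λ y≡v → suc (suc zero) , inj₁ refl , sym y≡v) ,
                                            (λ y≡w → zero , inj₂ refl , sym y≡w) ]′ (u-nbrs y uy)
    nbrs (suc (suc zero))          y vy = [ (λ y≡u → suc zero , inj₂ refl , sym y≡u) ,
                                            (λ y≡z → suc (suc (suc zero)) , inj₁ refl , sym y≡z) ]′ (v-nbrs y vy)
    nbrs (suc (suc (suc zero)))    y zy = suc (suc zero) , inj₂ refl , sym (proj₂ z-at-v y zy)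

    onto : ∀ x → ∃ λ i → ψ i ≡ x
    onto x = walk-preserves step-in (connected u x) (suc zero , refl)
      where
      step-in : ∀ {x y} → Adj x y → (∃ λ i → ψ i ≡ x) → ∃ λ j → ψ j ≡ y
      step-in xy (i , refl) = let (j , _ , ψj≡y) = nbrs i _ xy in j , ψj≡y

    reflect : ∀ i j → Adj (ψ i) (ψ j) → PathAdj i j
    reflect i j ψiψj = let (k , i~k , ψk≡ψj) = nbrs i (ψ j) ψiψj in
      subst (PathAdj i) (lookup-injective distinct k j ψk≡ψj) i~k

    edge : ∀ k → Adj (ψ (inject₁ k)) (ψ (suc k))
    edge zero             = proj₁ w-at-u
    edge (suc zero)       = uv
    edge (suc (suc zero)) = adj-sym (proj₁ z-at-v)

    preserve : ∀ i j → PathAdj i j → Adj (ψ i) (ψ j)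
    preserve i j (inj₁ i+1≡j) with consecutive i+1≡j
    ... | k , refl , refl = edge k
    preserve i j (inj₂ j+1≡i) with consecutive j+1≡i
    ... | k , refl , refl = adj-sym (edge k)

  isoP4-of-central-edge : ∀ {u v} → Adj u v → ¬ Leaf u → ¬ Leaf v →
    (∀ w → Adj u w → w ≢ v → Leaf w) → (∀ z → Adj v z → z ≢ u → Leaf z) → IsoP4 G
  isoP4-of-central-edge {u} {v} uv ¬leaf-u ¬leaf-v u-leafy v-leafy
    with other-neighbour uv (¬leaf-u ∘ (v ,_)) | other-neighbour (adj-sym uv) (¬leaf-v ∘ (u ,_))
  ... | w , uw , w≢v | z , vz , z≢u =
    isoP4-of-neighbourhoods w-at-u uv z-at-v w≢v z≢u (nbrs u-leafy w-at-u) (nbrs v-leafy z-at-v)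
    where
    w-at-u : PendantAt w u
    w-at-u = leaf⇒pendantAt (u-leafy w uw w≢v) (adj-sym uw)
    z-at-v : PendantAt z v
    z-at-v = leaf⇒pendantAt (v-leafy z vz z≢u) (adj-sym vz)
    nbrs : ∀ {x x' ℓ} → (∀ y → Adj x y → y ≢ x' → Leaf y) → PendantAt ℓ x → ∀ y → Adj x y → y ≡ x' ⊎ y ≡ ℓ
    nbrs {x' = x'} leafy ℓ-at-x y xy with y ≟ x'
    ... | yes y≡x' = inj₁ y≡x'
    ... | no  y≢x' = inj₂ (pendant-unique twinFree (leaf⇒pendantAt (leafy y xy y≢x') (adj-sym xy)) ℓ-at-x)

  nonLeaves-identifying : TriangleFree → ¬ IsoP4 G → IdentifyingCode G (∁ leaves)
  nonLeaves-identifying triangleFree ¬P4 = dominating , distinguishing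
    where
    nonLeaf∈ : ∀ {c} → ¬ Leaf c → c ∈ ∁ leaves
    nonLeaf∈ ¬leaf = x∉p⇒x∈∁p (¬leaf ∘ ∈-fromDec⁻ leaf?)

    dominating : ∀ v → ∃ λ c → c ∈ ∁ leaves × N[ v ] c
    dominating v with leaf? v
    ... | no  ¬leaf       = v , nonLeaf∈ ¬leaf , inj₁ refl
    ... | yes (s , v-at-s) = s , nonLeaf∈ (support-not-leaf v-at-s) , inj₂ (proj₁ v-at-s)

    two-leaves : ∀ {u v s t} → PendantAt u s → PendantAt v t → u ≢ v → Distinguishes (∁ leaves) u v
    two-leaves {u} {v} {s} {t} u-at-s v-at-t u≢v with s ≟ t
    ... | yes refl = contradiction (pendant-unique twinFree u-at-s v-at-t) u≢v
    ... | no  s≢t  = distinguishedBy (nonLeaf∈ (support-not-leaf u-at-s)) (inj₂ (proj₁ u-at-s))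
                       (∉N[] (λ { refl → support-not-leaf u-at-s (t , v-at-t) }) (λ vs → s≢t (proj₂ v-at-t s vs)))

    leaf-and-nonLeaf : ∀ {u s v} → PendantAt u s → ¬ Leaf v → u ≢ v → Distinguishes (∁ leaves) u v
    leaf-and-nonLeaf {u} {s} {v} u-at-s ¬leaf-v u≢v with v ≟ s
    ... | no  v≢s  = distinguishes-sym (distinguishedBy (nonLeaf∈ ¬leaf-v) (inj₁ refl)
                       (∉N[] (≢-sym u≢v) (λ uv → v≢s (proj₂ u-at-s v uv))))
    ... | yes refl =
          let (w , vw , w≢u) = support-has-other-neighbour u-at-s
              ¬leaf-w = λ w-leaf → w≢u (pendant-unique twinFree (leaf⇒pendantAt w-leaf (adj-sym vw)) u-at-s)
          in distinguishes-sym (distinguishedBy (nonLeaf∈ ¬leaf-w) (inj₂ vw)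
               (∉N[] w≢u (λ uw → irrefl (subst (Adj v) (proj₂ u-at-s w uw) vw))))

    nonLeaf-neighbour : ∀ x x' → Dec (∃ λ w → Adj x w × w ≢ x' × ¬ Leaf w)
    nonLeaf-neighbour x x' = any? (λ w → adj? x w ×-dec (¬? (w ≟ x') ×-dec ¬? (leaf? w)))

    only-leaves : ∀ {x x'} → ¬ (∃ λ w → Adj x w × w ≢ x' × ¬ Leaf w) → ∀ w → Adj x w → w ≢ x' → Leaf w
    only-leaves none w xw w≢x' = decidable-stable (leaf? w) (λ ¬leaf-w → none (w , xw , w≢x' , ¬leaf-w))

    two-nonLeaves : ∀ {u v} → ¬ Leaf u → ¬ Leaf v → u ≢ v → Distinguishes (∁ leaves) u v
    two-nonLeaves {u} {v} ¬leaf-u ¬leaf-v u≢v with adj? u v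
    ... | no ¬uv = distinguishedBy (nonLeaf∈ ¬leaf-u) (inj₁ refl) (∉N[] u≢v (¬uv ∘ adj-sym))
    ... | yes uv with nonLeaf-neighbour u v | nonLeaf-neighbour v u
    ...   | yes (w , uw , w≢v , ¬leaf-w) | _ =
            distinguishedBy (nonLeaf∈ ¬leaf-w) (inj₂ uw) (∉N[] w≢v (triangleFree uv uw))
    ...   | no _ | yes (z , vz , z≢u , ¬leaf-z) =
            distinguishes-sym (distinguishedBy (nonLeaf∈ ¬leaf-z) (inj₂ vz) (∉N[] z≢u (triangleFree (adj-sym uv) vz)))
    ...   | no none-u | no none-v =
            contradiction (isoP4-of-central-edge uv ¬leaf-u ¬leaf-v (only-leaves none-u) (only-leaves none-v)) ¬P4

    distinguishing : ∀ u v → u ≢ v → Distinguishes (∁ leaves) u v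
    distinguishing u v u≢v with leaf? u | leaf? v
    ... | yes (_ , u-at-s) | yes (_ , v-at-t) = two-leaves u-at-s v-at-t u≢v
    ... | yes (_ , u-at-s) | no  ¬leaf-v      = leaf-and-nonLeaf u-at-s ¬leaf-v u≢v
    ... | no  ¬leaf-u      | yes (_ , v-at-t) = distinguishes-sym (leaf-and-nonLeaf v-at-t ¬leaf-u (≢-sym u≢v))
    ... | no  ¬leaf-u      | no  ¬leaf-v      = two-nonLeaves ¬leaf-u ¬leaf-v u≢v

corollary8 : (n : ℕ) → 3 ≤ n → (G : Graph n) →
    Connected G → TwinFree G → Bipartite G → ¬ IsoP4 G →
    Σ (Subset n) λ C → IdentifyingCode G C × 3 * ∣ C ∣ ≤ 2 * n
corollary8 (suc zero)       (s≤s ())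
corollary8 (suc (suc zero)) (s≤s (s≤s ()))
corollary8 (suc (suc (suc m))) _ G connected twinFree (col , proper) ¬P4 =
  smallest-of-three ∣_∣ (IdentifyingCode G)
    (classCode partner leaves A) (classCode partner leaves (∁ A)) (∁ leaves)
    (classCode-identifying bip) (classCode-identifying (∁-bipartition bip))
    (nonLeaves-identifying (bipartition⇒triangleFree bip) ¬P4)
    (classCodes-total partner leaves A)
  where
  open GraphBasics G
  open Codes G connected twinFree
  A : Subset (3 + m)
  A = fromDec (λ v → col v ≟ᵇ true)
  bip : Bipartition A
  bip = colouring⇒bipartition col proper
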